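{- Define functions $S_k:\mathbb{Z}_{\ge0}\to\mathbb{Q}$ for $k\ge2$ recursively, together with $\tilde J_k(n)=\sum_{q=0}^n(-1)^q\binom{ -\frac12}{q}^{2}\binom nq S_k(q)$, by $S_2(p)=1$, $S_3(p)=-2\sum_{i=0}^{p-1}\frac{1}{(2i+1)^3}\binom{ -\frac12}{i}^{ -2}$, and for $k\ge4$ $$S_k(p)=\sum_{i=0}^{p-1}\frac{ -1}{(2i+1)^2}\binom{ -\frac12}{i}^{ -2}\sum_{j=0}^i(-1)^j\binom ij\tilde J_{k-2}(j+1).$$ For integers $i_1,\dots,i_r$ put $\varepsilon(i_1,\dots,i_r)=0$ if there is $1\le j<r$ with $i_j=i_{j+1}$ odd, and $\varepsilon(i_1,\dots,i_r)=1$ otherwise. Then for every $r\ge1$ and $p\ge0$, $$S_{2r+2}(p)=\sum_{1\le i_1\le\dots\le i_r\le 2p}\frac{(-1)^{i_1+\dots+i_r}}{i_1^2\cdots i_r^2}\varepsilon(i_1,\dots,i_r),$$ $$S_{2r+3}(p)=-2\sum_{\substack{j\ge1,\ i_1,\dots,i_r\\ 1\le 2j-1<i_1\le\dots\le i_r\le 2p}}\frac{1}{(2j-1)^3}\binom{ -\frac12}{j-1}^{ -2}\frac{(-1)^{i_1+\dots+i_r}}{i_1^2\cdots i_r^2}\varepsilon(i_1,\dots,i_r).$$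
   Context: $\binom{ -1/2}{p}=\frac{(-1/2)(-1/2-1)\cdots(-1/2-p+1)}{p!}$ is the generalized binomial coefficient. Empty sums are $0$. -}

module Defs where

open import Data.Bool using (Bool; true; false; if_then_else_; _∧_)
open import Data.Nat as ℕ using (ℕ; zero; suc; _∸_; _%_)
import Data.Nat.Properties as ℕP
open import Data.Nat.Combinatorics using (_C_)
open import Data.Integer as ℤ using (ℤ; +_)
open import Data.List using (List; []; _∷_; map; concatMap; upTo; [_])
open import Data.Rational using (ℚ; 0ℚ; 1ℚ; _+_; _*_; -_; _-_; 1/_; ≢-nonZero)
open import Data.Rational.Properties using (_≟_)
open import Relation.Nullary using (yes; no; does)

fromℕ : ℕ → ℚ
fromℕ n = (+ n) Data.Rational./ 1

-- total inverse: 1/x for x ≠ 0, and 0 for x = 0 (only ever applied to nonzero values)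
inv : ℚ → ℚ
inv x with x ≟ 0ℚ
... | yes _ = 0ℚ
... | no x≢0 = 1/_ x {{≢-nonZero x≢0}}

infixr 8 _^_
_^_ : ℚ → ℕ → ℚ
x ^ zero = 1ℚ
x ^ suc n = x * (x ^ n)

sgn : ℕ → ℚ
sgn n = (- 1ℚ) ^ n

sumTo : ℕ → (ℕ → ℚ) → ℚ
sumTo zero f = 0ℚ
sumTo (suc n) f = sumTo n f + f n

gbinom : ℚ → ℕ → ℚ
gbinom a zero = 1ℚ
gbinom a (suc p) = gbinom a p * (a - fromℕ p) * inv (fromℕ (suc p))

mhalf : ℚ
mhalf = ℤ.-[1+ 0 ] Data.Rational./ 2

binvsq : ℕ → ℚ
binvsq i = inv (gbinom mhalf i ^ 2)

-- S k p  and  J̃ k n  (S is meaningful for k ≥ 2; S 0 = S 1 = 0 by convention, unused)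
mutual
  S : ℕ → ℕ → ℚ
  S zero p = 0ℚ
  S (suc zero) p = 0ℚ
  S (suc (suc zero)) p = 1ℚ
  S (suc (suc (suc zero))) p =
    - (fromℕ 2) * sumTo p (λ i → inv (fromℕ (2 ℕ.* i ℕ.+ 1) ^ 3) * binvsq i)
  S (suc (suc (suc (suc k)))) p =
    sumTo p (λ i → (- 1ℚ) * inv (fromℕ (2 ℕ.* i ℕ.+ 1) ^ 2) * binvsq i
      * sumTo (suc i) (λ j → sgn j * fromℕ (i C j) * Jt (suc (suc k)) (suc j)))

  Jt : ℕ → ℕ → ℚ
  Jt k n = sumTo (suc n) (λ q → sgn q * (gbinom mhalf q ^ 2) * fromℕ (n C q) * S k q)

range : ℕ → ℕ → List ℕ
range lo hi = map (lo ℕ.+_) (upTo (suc hi ∸ lo))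

incSeqs : ℕ → ℕ → ℕ → List (List ℕ)
incSeqs zero lo hi = [ [] ]
incSeqs (suc r) lo hi = concatMap (λ i → map (i ∷_) (incSeqs r i hi)) (range lo hi)

sumList : List (List ℕ) → (List ℕ → ℚ) → ℚ
sumList [] f = 0ℚ
sumList (x ∷ xs) f = f x + sumList xs f

ε : List ℕ → ℚ
ε [] = 1ℚ
ε (a ∷ []) = 1ℚ
ε (a ∷ b ∷ rest) =
  if does (a ℕ.≟ b) ∧ does (a % 2 ℕ.≟ 1) then 0ℚ else ε (b ∷ rest)

sumℕ : List ℕ → ℕ
sumℕ [] = 0
sumℕ (x ∷ xs) = x ℕ.+ sumℕ xs

prodSq : List ℕ → ℕ
prodSq [] = 1
prodSq (x ∷ xs) = x ℕ.* x ℕ.* prodSq xs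

term : List ℕ → ℚ
term is = sgn (sumℕ is) * inv (fromℕ (prodSq is)) * ε is

evenRHS : ℕ → ℕ → ℚ
evenRHS r p = sumList (incSeqs r 1 (2 ℕ.* p)) term

-- right-hand side for S_{2r+3}(p); j = j'+1 runs over 1..p
-- (2j-1 < i₁ ≤ 2p forces j ≤ p), and 2j-1 < i₁ means i₁ ≥ 2j
oddRHS : ℕ → ℕ → ℚ
oddRHS r p =
  - (fromℕ 2) * sumTo p (λ j' →
      inv (fromℕ (2 ℕ.* j' ℕ.+ 1) ^ 3) * binvsq j'
      * sumList (incSeqs r (2 ℕ.* suc j') (2 ℕ.* p)) term)

-- Write β(q) = binom(-1/2, q) and w(m) = (-1)^m / m². Since J̃_k is the binomial transform of
-- (-1)^q β(q)² S_k(q), binomial inversion evaluates the alternating inner sum in the definition of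
-- S_{k+2}, and with β(p+1)/β(p) = -(2p+1)/(2p+2) this gives the first-order recurrence
--   S_{k+2}(p+1) = S_{k+2}(p) + w(2p+2) S_k(p+1) + w(2p+1) S_k(p).
-- Splitting off the indices 2p+1 and 2p+2 at the top of a sequence i₁ ≤ … ≤ i_r ≤ 2p+2 shows that
-- both right-hand sides satisfy the same recurrence in (r, p); a family obeying it is determined by
-- its values at r = 0 and at p = 0, where everything can be checked directly.
module Submission where

open import Defs

module _ where
  open import Data.Bool.Properties using (∧-zeroʳ)
  open import Data.Empty using (⊥-elim)
  import Data.Integer as ℤ
  import Data.Integer.Properties as ℤ
  open import Data.List using (List; []; _∷_; [_]; _++_; _∷ʳ_; map; concatMap; applyUpTo)
  open import Data.List.Properties using (++-identityʳ; applyUpTo-∷ʳ; concatMap-++; map-applyUpTo)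
  open import Data.Nat as ℕ using (ℕ; zero; suc; _∸_; _%_; _≤_; _<_; z≤n; s≤s)
  import Data.Nat.Properties as ℕ
  open import Data.Nat.Combinatorics using (_C_; nCk+nC[k+1]≡[n+1]C[k+1])
  open import Data.Nat.Combinatorics.Specification using (k>n⇒nCk≡0)
  open import Data.Nat.DivMod using ([m+kn]%n≡m%n; m*n%n≡0)
  open import Data.Rational using (ℚ; 0ℚ; 1ℚ; _+_; _*_; -_; _-_; toℚᵘ; ≢-nonZero)
  open import Data.Rational.Properties
    using (_≟_; toℚᵘ-injective; toℚᵘ-fromℚᵘ; toℚᵘ-homo-+; toℚᵘ-homo-*; *-inverseˡ;
           +-identityˡ; +-identityʳ; +-assoc; *-identityˡ; *-identityʳ; *-assoc; *-zeroˡ; *-zeroʳ;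
           *-distribˡ-+; *-distribʳ-+)
  open import Data.Rational.Solver using (module +-*-Solver)
  open import Data.Rational.Unnormalised as ℚᵘ using (mkℚᵘ)
  import Data.Rational.Unnormalised.Properties as ℚᵘ
  open import Data.Sum using (_⊎_; inj₁; inj₂)
  open import Relation.Binary.PropositionalEquality using (_≡_; _≢_; refl; sym; trans; cong; cong₂; subst; module ≡-Reasoning)
  open import Relation.Nullary using (yes; no; Dec)
  open import Relation.Nullary.Decidable using (dec-false; dec-true; does)
  open +-*-Solver

  toℚᵘ-fromℕ : ∀ n → toℚᵘ (fromℕ n) ℚᵘ.≃ mkℚᵘ (ℤ.+ n) 0
  toℚᵘ-fromℕ n = toℚᵘ-fromℚᵘ (mkℚᵘ (ℤ.+ n) 0)

  fromℕ-+ : ∀ m n → fromℕ (m ℕ.+ n) ≡ fromℕ m + fromℕ n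
  fromℕ-+ m n = toℚᵘ-injective (begin
    toℚᵘ (fromℕ (m ℕ.+ n))              ≈⟨ toℚᵘ-fromℕ (m ℕ.+ n) ⟩
    mkℚᵘ (ℤ.+ (m ℕ.+ n)) 0              ≡⟨ cong (λ z → mkℚᵘ z 0) (cong₂ ℤ._+_ (ℤ.*-identityʳ (ℤ.+ m)) (ℤ.*-identityʳ (ℤ.+ n))) ⟨
    mkℚᵘ (ℤ.+ m) 0 ℚᵘ.+ mkℚᵘ (ℤ.+ n) 0  ≈⟨ ℚᵘ.+-cong (toℚᵘ-fromℕ m) (toℚᵘ-fromℕ n) ⟨
    toℚᵘ (fromℕ m) ℚᵘ.+ toℚᵘ (fromℕ n)  ≈⟨ toℚᵘ-homo-+ (fromℕ m) (fromℕ n) ⟨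
    toℚᵘ (fromℕ m + fromℕ n)            ∎)
    where open ℚᵘ.≃-Reasoning

  fromℕ-* : ∀ m n → fromℕ (m ℕ.* n) ≡ fromℕ m * fromℕ n
  fromℕ-* m n = toℚᵘ-injective (begin
    toℚᵘ (fromℕ (m ℕ.* n))              ≈⟨ toℚᵘ-fromℕ (m ℕ.* n) ⟩
    mkℚᵘ (ℤ.+ (m ℕ.* n)) 0              ≡⟨ cong (λ z → mkℚᵘ z 0) (ℤ.pos-* m n) ⟩
    mkℚᵘ (ℤ.+ m) 0 ℚᵘ.* mkℚᵘ (ℤ.+ n) 0  ≈⟨ ℚᵘ.*-cong (toℚᵘ-fromℕ m) (toℚᵘ-fromℕ n) ⟨
    toℚᵘ (fromℕ m) ℚᵘ.* toℚᵘ (fromℕ n)  ≈⟨ toℚᵘ-homo-* (fromℕ m) (fromℕ n) ⟨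
    toℚᵘ (fromℕ m * fromℕ n)            ∎)
    where open ℚᵘ.≃-Reasoning

  fromℕ-suc≢0 : ∀ n → fromℕ (suc n) ≢ 0ℚ
  fromℕ-suc≢0 n eq
    with ℚᵘ.p≃0⇒↥p≡0 _ (ℚᵘ.≃-trans (ℚᵘ.≃-sym (toℚᵘ-fromℕ (suc n))) (ℚᵘ.≃-reflexive (cong toℚᵘ eq)))
  ... | ()

  open ≡-Reasoning

  fromℕ-square : ∀ m → fromℕ m ^ 2 ≡ fromℕ (m ℕ.* m)
  fromℕ-square m = trans (cong (fromℕ m *_) (*-identityʳ (fromℕ m))) (sym (fromℕ-* m m))

  fromℕ-2n+1≢0 : ∀ n → fromℕ (2 ℕ.* n ℕ.+ 1) ≢ 0ℚ
  fromℕ-2n+1≢0 n = subst (λ m → fromℕ m ≢ 0ℚ) (ℕ.+-comm 1 (2 ℕ.* n)) (fromℕ-suc≢0 (2 ℕ.* n))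

  inv-inverseˡ : ∀ {x} → x ≢ 0ℚ → inv x * x ≡ 1ℚ
  inv-inverseˡ {x} x≢0 with x ≟ 0ℚ
  ... | yes x≡0 = ⊥-elim (x≢0 x≡0)
  ... | no x≢0′ = *-inverseˡ x {{≢-nonZero x≢0′}}

  inv-unique : ∀ x {y} → x * y ≡ 1ℚ → inv x ≡ y
  inv-unique x {y} xy≡1 = begin
    inv x            ≡⟨ *-identityʳ (inv x) ⟨
    inv x * 1ℚ       ≡⟨ cong (inv x *_) xy≡1 ⟨
    inv x * (x * y)  ≡⟨ *-assoc (inv x) x y ⟨
    inv x * x * y    ≡⟨ cong (_* y) (inv-inverseˡ x≢0) ⟩
    1ℚ * y           ≡⟨ *-identityˡ y ⟩
    y                ∎
    where
    x≢0 : x ≢ 0ℚ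
    x≢0 x≡0 with trans (sym xy≡1) (trans (cong (_* y) x≡0) (*-zeroˡ y))
    ... | ()

  inv-* : ∀ x y → inv (x * y) ≡ inv x * inv y
  inv-* x y = cases (x ≟ 0ℚ) (y ≟ 0ℚ)
    where
    cases : Dec (x ≡ 0ℚ) → Dec (y ≡ 0ℚ) → inv (x * y) ≡ inv x * inv y
    cases (yes refl) _ = trans (cong inv (*-zeroˡ y)) (sym (*-zeroˡ (inv y)))
    cases (no _) (yes refl) = trans (cong inv (*-zeroʳ x)) (sym (*-zeroʳ (inv x)))
    cases (no x≢0) (no y≢0) = inv-unique (x * y) (begin
      x * y * (inv x * inv y)  ≡⟨ solve 4 (λ a b c d → a :* b :* (c :* d) := (c :* a) :* (d :* b)) refl x y (inv x) (inv y) ⟩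
      inv x * x * (inv y * y)  ≡⟨ cong₂ _*_ (inv-inverseˡ x≢0) (inv-inverseˡ y≢0) ⟩
      1ℚ                       ∎)

  inv-≢0 : ∀ {x} → x ≢ 0ℚ → inv x ≢ 0ℚ
  inv-≢0 {x} x≢0 inv≡0 with trans (sym (inv-inverseˡ x≢0)) (trans (cong (_* x) inv≡0) (*-zeroˡ x))
  ... | ()

  *-≢0 : ∀ {x y} → x ≢ 0ℚ → y ≢ 0ℚ → x * y ≢ 0ℚ
  *-≢0 {x} {y} x≢0 y≢0 xy≡0 = y≢0 (begin
    y                ≡⟨ *-identityˡ y ⟨
    1ℚ * y           ≡⟨ cong (_* y) (inv-inverseˡ x≢0) ⟨
    inv x * x * y    ≡⟨ *-assoc (inv x) x y ⟩
    inv x * (x * y)  ≡⟨ cong (inv x *_) xy≡0 ⟩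
    inv x * 0ℚ       ≡⟨ *-zeroʳ (inv x) ⟩
    0ℚ               ∎)

  ^2-≢0 : ∀ {x} → x ≢ 0ℚ → x ^ 2 ≢ 0ℚ
  ^2-≢0 x≢0 = *-≢0 x≢0 (*-≢0 x≢0 λ ())

  sgn-+ : ∀ m n → sgn (m ℕ.+ n) ≡ sgn m * sgn n
  sgn-+ zero n = sym (*-identityˡ (sgn n))
  sgn-+ (suc m) n = trans (cong ((- 1ℚ) *_) (sgn-+ m n)) (sym (*-assoc (- 1ℚ) (sgn m) (sgn n)))

  sgn*sgn≡1 : ∀ n → sgn n * sgn n ≡ 1ℚ
  sgn*sgn≡1 zero = refl
  sgn*sgn≡1 (suc n) = trans (solve 1 (λ s → (:- con 1ℚ :* s) :* (:- con 1ℚ :* s) := s :* s) refl (sgn n)) (sgn*sgn≡1 n)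

  sgn-2n : ∀ n → sgn (2 ℕ.* n) ≡ 1ℚ
  sgn-2n n = trans (cong (λ m → sgn (n ℕ.+ m)) (ℕ.+-identityʳ n)) (trans (sgn-+ n n) (sgn*sgn≡1 n))

  2[1+n]≡2+2n : ∀ n → 2 ℕ.* suc n ≡ 2 ℕ.+ 2 ℕ.* n
  2[1+n]≡2+2n n = ℕ.*-distribˡ-+ 2 1 n

  altInvSq : ℕ → ℚ
  altInvSq m = sgn m * inv (fromℕ (m ℕ.* m))

  altInvSq-2n : ∀ n → altInvSq (2 ℕ.* n) ≡ inv (fromℕ (2 ℕ.* n) ^ 2)
  altInvSq-2n n = begin
    sgn (2 ℕ.* n) * inv (fromℕ (2 ℕ.* n ℕ.* (2 ℕ.* n)))  ≡⟨ cong₂ _*_ (sgn-2n n) (cong inv (sym (fromℕ-square (2 ℕ.* n)))) ⟩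
    1ℚ * inv (fromℕ (2 ℕ.* n) ^ 2)                       ≡⟨ *-identityˡ _ ⟩
    inv (fromℕ (2 ℕ.* n) ^ 2)                            ∎

  β : ℕ → ℚ
  β = gbinom mhalf

  -2*[mhalf-n]≡2n+1 : ∀ n → (- fromℕ 2) * (mhalf - fromℕ n) ≡ fromℕ (2 ℕ.* n ℕ.+ 1)
  -2*[mhalf-n]≡2n+1 n = begin
    (- fromℕ 2) * (mhalf - fromℕ n)
      ≡⟨ solve 3 (λ t h x → (:- t) :* (h :- x) := t :* x :+ (:- t) :* h) refl (fromℕ 2) mhalf (fromℕ n) ⟩
    fromℕ 2 * fromℕ n + (- fromℕ 2) * mhalf
      ≡⟨ cong (_+ 1ℚ) (fromℕ-* 2 n) ⟨
    fromℕ (2 ℕ.* n) + 1ℚ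
      ≡⟨ fromℕ-+ (2 ℕ.* n) 1 ⟨
    fromℕ (2 ℕ.* n ℕ.+ 1) ∎

  β≢0 : ∀ n → β n ≢ 0ℚ
  β≢0 zero ()
  β≢0 (suc n) = *-≢0 (*-≢0 (β≢0 n) mhalf-n≢0) (inv-≢0 (fromℕ-suc≢0 n))
    where
    mhalf-n≢0 : mhalf - fromℕ n ≢ 0ℚ
    mhalf-n≢0 eq = fromℕ-2n+1≢0 n (begin
      fromℕ (2 ℕ.* n ℕ.+ 1)            ≡⟨ -2*[mhalf-n]≡2n+1 n ⟨
      (- fromℕ 2) * (mhalf - fromℕ n)  ≡⟨ cong ((- fromℕ 2) *_) eq ⟩
      (- fromℕ 2) * 0ℚ                 ≡⟨ *-zeroʳ (- fromℕ 2) ⟩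
      0ℚ                               ∎)

  binvsq*β²≡1 : ∀ n → binvsq n * β n ^ 2 ≡ 1ℚ
  binvsq*β²≡1 n = inv-inverseˡ (^2-≢0 (β≢0 n))

  altInvSq-odd : ∀ n → (- 1ℚ) * inv (fromℕ (2 ℕ.* n ℕ.+ 1) ^ 2) ≡ altInvSq (suc (2 ℕ.* n))
  altInvSq-odd n = begin
    (- 1ℚ) * inv (fromℕ (2 ℕ.* n ℕ.+ 1) ^ 2)
      ≡⟨ cong (λ m → (- 1ℚ) * inv (fromℕ m ^ 2)) (ℕ.+-comm (2 ℕ.* n) 1) ⟩
    (- 1ℚ) * inv (fromℕ m ^ 2)
      ≡⟨ cong (_* inv (fromℕ m ^ 2)) (*-identityʳ (- 1ℚ)) ⟨
    (- 1ℚ) * 1ℚ * inv (fromℕ m ^ 2)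
      ≡⟨ cong₂ (λ s x → (- 1ℚ) * s * inv x) (sym (sgn-2n n)) (fromℕ-square m) ⟩
    altInvSq m ∎
    where m = suc (2 ℕ.* n)

  altInvSq-even : ∀ n → inv (fromℕ (2 ℕ.* n ℕ.+ 1) ^ 2) * binvsq n * β (suc n) ^ 2 ≡ altInvSq (2 ℕ.* suc n)
  altInvSq-even n = sym (begin
    altInvSq (2 ℕ.* suc n)              ≡⟨ altInvSq-2n (suc n) ⟩
    inv (fromℕ (2 ℕ.* suc n) ^ 2)       ≡⟨ cong (λ x → inv (x ^ 2)) (fromℕ-* 2 (suc n)) ⟩
    inv ((t * f) ^ 2)                   ≡⟨ inv-unique ((t * f) ^ 2) product≡1 ⟩
    u * binvsq n * β (suc n) ^ 2        ∎)
    where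
    t = fromℕ 2
    f = fromℕ (suc n)
    c = mhalf - fromℕ n
    d = fromℕ (2 ℕ.* n ℕ.+ 1)
    u = inv (d ^ 2)
    product≡1 : (t * f) ^ 2 * (u * binvsq n * β (suc n) ^ 2) ≡ 1ℚ
    product≡1 = begin
      (t * f) ^ 2 * (u * binvsq n * (β n * c * inv f) ^ 2)
        ≡⟨ solve 7 (λ t f u b g c v → (t :* f) :* ((t :* f) :* con 1ℚ) :* (u :* b :* ((g :* c :* v) :* ((g :* c :* v) :* con 1ℚ)))
                       := (b :* (g :* (g :* con 1ℚ))) :* ((v :* f) :* (v :* f)) :* (u :* (((:- t) :* c) :* (((:- t) :* c) :* con 1ℚ))))
             refl t f u (binvsq n) (β n) c (inv f) ⟩
      binvsq n * β n ^ 2 * (inv f * f * (inv f * f)) * (u * ((- t) * c) ^ 2)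
        ≡⟨ cong₂ (λ x y → x * (y * y) * (u * ((- t) * c) ^ 2)) (binvsq*β²≡1 n) (inv-inverseˡ (fromℕ-suc≢0 n)) ⟩
      1ℚ * (1ℚ * 1ℚ) * (u * ((- t) * c) ^ 2)
        ≡⟨ cong (λ x → 1ℚ * (1ℚ * 1ℚ) * (u * x ^ 2)) (-2*[mhalf-n]≡2n+1 n) ⟩
      1ℚ * (1ℚ * 1ℚ) * (u * d ^ 2)
        ≡⟨ cong (1ℚ * (1ℚ * 1ℚ) *_) (inv-inverseˡ (^2-≢0 (fromℕ-2n+1≢0 n))) ⟩
      1ℚ ∎

  sumTo-cong : ∀ n {f g : ℕ → ℚ} → (∀ q → q < n → f q ≡ g q) → sumTo n f ≡ sumTo n g
  sumTo-cong zero f≗g = refl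
  sumTo-cong (suc n) f≗g = cong₂ _+_ (sumTo-cong n (λ q q<n → f≗g q (ℕ.m<n⇒m<1+n q<n))) (f≗g n ℕ.≤-refl)

  sumTo-shift : ∀ n f → sumTo (suc n) f ≡ f 0 + sumTo n (λ q → f (suc q))
  sumTo-shift zero f = trans (+-identityˡ (f 0)) (sym (+-identityʳ (f 0)))
  sumTo-shift (suc n) f = trans (cong (_+ f (suc n)) (sumTo-shift n f)) (+-assoc (f 0) _ _)

  sumTo-+ : ∀ n f g → sumTo n (λ q → f q + g q) ≡ sumTo n f + sumTo n g
  sumTo-+ zero f g = refl
  sumTo-+ (suc n) f g = trans (cong (_+ (f n + g n)) (sumTo-+ n f g))
    (solve 4 (λ a b c d → a :+ b :+ (c :+ d) := a :+ c :+ (b :+ d)) refl (sumTo n f) (sumTo n g) (f n) (g n))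

  sumTo-*ˡ : ∀ n c f → sumTo n (λ q → c * f q) ≡ c * sumTo n f
  sumTo-*ˡ zero c f = sym (*-zeroʳ c)
  sumTo-*ˡ (suc n) c f = trans (cong (_+ c * f n) (sumTo-*ˡ n c f)) (sym (*-distribˡ-+ c (sumTo n f) (f n)))

  binomialSum : ℕ → (ℕ → ℚ) → ℚ
  binomialSum n a = sumTo (suc n) (λ q → fromℕ (n C q) * a q)

  binomialSum-cong : ∀ n {a b : ℕ → ℚ} → (∀ q → a q ≡ b q) → binomialSum n a ≡ binomialSum n b
  binomialSum-cong n a≗b = sumTo-cong (suc n) (λ q _ → cong (fromℕ (n C q) *_) (a≗b q))

  binomialSum-+ : ∀ n a b → binomialSum n (λ q → a q + b q) ≡ binomialSum n a + binomialSum n b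
  binomialSum-+ n a b = trans (sumTo-cong (suc n) (λ q _ → *-distribˡ-+ (fromℕ (n C q)) (a q) (b q))) (sumTo-+ (suc n) _ _)

  binomialSum-*ˡ : ∀ n c a → binomialSum n (λ q → c * a q) ≡ c * binomialSum n a
  binomialSum-*ˡ n c a = trans
    (sumTo-cong (suc n) (λ q _ → solve 3 (λ x y z → x :* (y :* z) := y :* (x :* z)) refl (fromℕ (n C q)) c (a q)))
    (sumTo-*ˡ (suc n) c _)

  binomialSum-suc : ∀ n a → binomialSum (suc n) a ≡ binomialSum n a + binomialSum n (λ q → a (suc q))
  binomialSum-suc n a = begin
    binomialSum (suc n) a
      ≡⟨ sumTo-shift (suc n) _ ⟩
    fromℕ 1 * a 0 + sumTo (suc n) (λ q → fromℕ (suc n C suc q) * a (suc q))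
      ≡⟨ cong (fromℕ 1 * a 0 +_) (trans (sumTo-cong (suc n) pascal) (sumTo-+ (suc n) _ _)) ⟩
    fromℕ 1 * a 0 + (binomialSum n (λ q → a (suc q)) + upper)
      ≡⟨ solve 3 (λ x y z → x :+ (y :+ z) := x :+ z :+ y) refl (fromℕ 1 * a 0) (binomialSum n (λ q → a (suc q))) upper ⟩
    fromℕ 1 * a 0 + upper + binomialSum n (λ q → a (suc q))
      ≡⟨ cong (_+ binomialSum n (λ q → a (suc q))) binomialSum≡head+upper ⟨
    binomialSum n a + binomialSum n (λ q → a (suc q)) ∎
    where
    upper = sumTo (suc n) (λ q → fromℕ (n C suc q) * a (suc q))
    pascal : ∀ q → q < suc n →
      fromℕ (suc n C suc q) * a (suc q) ≡ fromℕ (n C q) * a (suc q) + fromℕ (n C suc q) * a (suc q)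
    pascal q _ = begin
      fromℕ (suc n C suc q) * a (suc q)
        ≡⟨ cong (λ m → fromℕ m * a (suc q)) (nCk+nC[k+1]≡[n+1]C[k+1] n q) ⟨
      fromℕ (n C q ℕ.+ n C suc q) * a (suc q)
        ≡⟨ cong (_* a (suc q)) (fromℕ-+ (n C q) (n C suc q)) ⟩
      (fromℕ (n C q) + fromℕ (n C suc q)) * a (suc q)
        ≡⟨ *-distribʳ-+ (a (suc q)) (fromℕ (n C q)) (fromℕ (n C suc q)) ⟩
      fromℕ (n C q) * a (suc q) + fromℕ (n C suc q) * a (suc q) ∎
    binomialSum≡head+upper : binomialSum n a ≡ fromℕ 1 * a 0 + upper
    binomialSum≡head+upper = begin
      binomialSum n a
        ≡⟨ +-identityʳ (binomialSum n a) ⟨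
      binomialSum n a + 0ℚ
        ≡⟨ cong (binomialSum n a +_) (*-zeroˡ (a (suc n))) ⟨
      binomialSum n a + fromℕ 0 * a (suc n)
        ≡⟨ cong (λ m → binomialSum n a + fromℕ m * a (suc n)) (k>n⇒nCk≡0 (ℕ.n<1+n n)) ⟨
      sumTo (suc (suc n)) (λ q → fromℕ (n C q) * a q)
        ≡⟨ sumTo-shift (suc n) _ ⟩
      fromℕ 1 * a 0 + upper ∎

  binomial-inversion : ∀ n a → binomialSum n (λ j → sgn j * binomialSum j a) ≡ sgn n * a n
  binomial-inversion zero a =
    solve 1 (λ x → con 0ℚ :+ con 1ℚ :* (con 1ℚ :* (con 0ℚ :+ con 1ℚ :* x)) := con 1ℚ :* x) refl (a 0)
  binomial-inversion (suc n) a = begin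
    binomialSum (suc n) T
      ≡⟨ binomialSum-suc n T ⟩
    binomialSum n T + binomialSum n (λ j → T (suc j))
      ≡⟨ cong (binomialSum n T +_) shifted ⟩
    binomialSum n T + (- 1ℚ) * (binomialSum n T + binomialSum n (λ j → sgn j * binomialSum j (λ q → a (suc q))))
      ≡⟨ cong₂ (λ x y → x + (- 1ℚ) * (x + y)) (binomial-inversion n a) (binomial-inversion n (λ q → a (suc q))) ⟩
    sgn n * a n + (- 1ℚ) * (sgn n * a n + sgn n * a (suc n))
      ≡⟨ solve 3 (λ s x y → s :* x :+ (:- con 1ℚ) :* (s :* x :+ s :* y) := (:- con 1ℚ) :* s :* y) refl (sgn n) (a n) (a (suc n)) ⟩
    sgn (suc n) * a (suc n) ∎
    where
    T : ℕ → ℚ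
    T j = sgn j * binomialSum j a
    shifted : binomialSum n (λ j → T (suc j))
            ≡ (- 1ℚ) * (binomialSum n T + binomialSum n (λ j → sgn j * binomialSum j (λ q → a (suc q))))
    shifted = begin
      binomialSum n (λ j → T (suc j))
        ≡⟨ binomialSum-cong n (λ j → *-assoc (- 1ℚ) (sgn j) _) ⟩
      binomialSum n (λ j → (- 1ℚ) * (sgn j * binomialSum (suc j) a))
        ≡⟨ binomialSum-*ˡ n (- 1ℚ) _ ⟩
      (- 1ℚ) * binomialSum n (λ j → sgn j * binomialSum (suc j) a)
        ≡⟨ cong ((- 1ℚ) *_) (binomialSum-cong n (λ j → trans (cong (sgn j *_) (binomialSum-suc j a)) (*-distribˡ-+ (sgn j) _ _))) ⟩
      (- 1ℚ) * binomialSum n (λ j → T j + sgn j * binomialSum j (λ q → a (suc q)))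
        ≡⟨ cong ((- 1ℚ) *_) (binomialSum-+ n _ _) ⟩
      (- 1ℚ) * (binomialSum n T + binomialSum n (λ j → sgn j * binomialSum j (λ q → a (suc q)))) ∎

  Jt≡binomialSum : ∀ k n → Jt k n ≡ binomialSum n (λ q → sgn q * β q ^ 2 * S k q)
  Jt≡binomialSum k n = sumTo-cong (suc n) (λ q _ →
    solve 4 (λ s b c x → s :* b :* c :* x := c :* (s :* b :* x)) refl (sgn q) (β q ^ 2) (fromℕ (n C q)) (S k q))

  alternating-Jt : ∀ k i → sumTo (suc i) (λ j → sgn j * fromℕ (i C j) * Jt k (suc j))
                         ≡ β i ^ 2 * S k i - β (suc i) ^ 2 * S k (suc i)
  alternating-Jt k i = begin
    sumTo (suc i) (λ j → sgn j * fromℕ (i C j) * Jt k (suc j))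
      ≡⟨ sumTo-cong (suc i) (λ j _ → solve 3 (λ s c x → s :* c :* x := c :* (s :* x)) refl (sgn j) (fromℕ (i C j)) (Jt k (suc j))) ⟩
    binomialSum i (λ j → sgn j * Jt k (suc j))
      ≡⟨ binomialSum-cong i (λ j → cong (sgn j *_) (trans (Jt≡binomialSum k (suc j)) (binomialSum-suc j α))) ⟩
    binomialSum i (λ j → sgn j * (binomialSum j α + binomialSum j (λ q → α (suc q))))
      ≡⟨ trans (binomialSum-cong i (λ j → *-distribˡ-+ (sgn j) _ _)) (binomialSum-+ i _ _) ⟩
    binomialSum i (λ j → sgn j * binomialSum j α) + binomialSum i (λ j → sgn j * binomialSum j (λ q → α (suc q)))
      ≡⟨ cong₂ _+_ (binomial-inversion i α) (binomial-inversion i (λ q → α (suc q))) ⟩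
    sgn i * α i + sgn i * α (suc i)
      ≡⟨ solve 5 (λ s b₀ b₁ x₀ x₁ → s :* (s :* b₀ :* x₀) :+ s :* ((:- con 1ℚ) :* s :* b₁ :* x₁)
                     := s :* s :* (b₀ :* x₀ :- b₁ :* x₁))
           refl (sgn i) (β i ^ 2) (β (suc i) ^ 2) (S k i) (S k (suc i)) ⟩
    sgn i * sgn i * (β i ^ 2 * S k i - β (suc i) ^ 2 * S k (suc i))
      ≡⟨ cong (_* (β i ^ 2 * S k i - β (suc i) ^ 2 * S k (suc i))) (sgn*sgn≡1 i) ⟩
    1ℚ * (β i ^ 2 * S k i - β (suc i) ^ 2 * S k (suc i))
      ≡⟨ *-identityˡ _ ⟩
    β i ^ 2 * S k i - β (suc i) ^ 2 * S k (suc i) ∎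
    where
    α : ℕ → ℚ
    α q = sgn q * β q ^ 2 * S k q

  S-suc : ∀ k i → S (4 ℕ.+ k) (suc i)
                ≡ S (4 ℕ.+ k) i + (altInvSq (2 ℕ.* suc i) * S (2 ℕ.+ k) (suc i) + altInvSq (suc (2 ℕ.* i)) * S (2 ℕ.+ k) i)
  S-suc k i = cong (S (4 ℕ.+ k) i +_) (begin
    (- 1ℚ) * u * binvsq i * sumTo (suc i) (λ j → sgn j * fromℕ (i C j) * Jt (2 ℕ.+ k) (suc j))
      ≡⟨ cong ((- 1ℚ) * u * binvsq i *_) (alternating-Jt (2 ℕ.+ k) i) ⟩
    (- 1ℚ) * u * binvsq i * (β i ^ 2 * x₀ - β (suc i) ^ 2 * x₁)
      ≡⟨ solve 6 (λ u b g₀ g₁ x₀ x₁ → (:- con 1ℚ) :* u :* b :* (g₀ :* x₀ :- g₁ :* x₁)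
                     := u :* b :* g₁ :* x₁ :+ b :* g₀ :* ((:- con 1ℚ) :* u) :* x₀)
           refl u (binvsq i) (β i ^ 2) (β (suc i) ^ 2) x₀ x₁ ⟩
    u * binvsq i * β (suc i) ^ 2 * x₁ + binvsq i * β i ^ 2 * ((- 1ℚ) * u) * x₀
      ≡⟨ cong₂ (λ y z → y * x₁ + z * x₀) (altInvSq-even i) (cong₂ _*_ (binvsq*β²≡1 i) (altInvSq-odd i)) ⟩
    altInvSq (2 ℕ.* suc i) * x₁ + 1ℚ * altInvSq (suc (2 ℕ.* i)) * x₀
      ≡⟨ cong (λ y → altInvSq (2 ℕ.* suc i) * x₁ + y * x₀) (*-identityˡ (altInvSq (suc (2 ℕ.* i)))) ⟩
    altInvSq (2 ℕ.* suc i) * x₁ + altInvSq (suc (2 ℕ.* i)) * x₀ ∎)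
    where
    u = inv (fromℕ (2 ℕ.* i ℕ.+ 1) ^ 2)
    x₀ = S (2 ℕ.+ k) i
    x₁ = S (2 ℕ.+ k) (suc i)

  sumRange : ℕ → ℕ → (ℕ → ℚ) → ℚ
  sumRange lo hi g = sumTo (suc hi ∸ lo) (λ k → g (lo ℕ.+ k))

  <∸⇒+≤ : ∀ lo hi k → k < suc hi ∸ lo → lo ℕ.+ k ≤ hi
  <∸⇒+≤ zero hi k (s≤s k≤hi) = k≤hi
  <∸⇒+≤ (suc lo) zero k k<0 rewrite ℕ.0∸n≡0 lo with k<0
  ... | ()
  <∸⇒+≤ (suc lo) (suc hi) k k<hi∸lo = s≤s (<∸⇒+≤ lo hi k k<hi∸lo)

  sumRange-cong : ∀ lo hi {g h : ℕ → ℚ} → (∀ i → lo ≤ i → i ≤ hi → g i ≡ h i) → sumRange lo hi g ≡ sumRange lo hi h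
  sumRange-cong lo hi g≗h = sumTo-cong (suc hi ∸ lo) (λ k k< → g≗h (lo ℕ.+ k) (ℕ.m≤m+n lo k) (<∸⇒+≤ lo hi k k<))

  sumRange-+ : ∀ lo hi g h → sumRange lo hi (λ i → g i + h i) ≡ sumRange lo hi g + sumRange lo hi h
  sumRange-+ lo hi g h = sumTo-+ (suc hi ∸ lo) _ _

  sumRange-*ˡ : ∀ lo hi c g → sumRange lo hi (λ i → c * g i) ≡ c * sumRange lo hi g
  sumRange-*ˡ lo hi c g = sumTo-*ˡ (suc hi ∸ lo) c _

  sumRange-empty : ∀ lo hi g → hi < lo → sumRange lo hi g ≡ 0ℚ
  sumRange-empty lo hi g hi<lo rewrite ℕ.m≤n⇒m∸n≡0 hi<lo = refl

  sumRange-head : ∀ lo hi g → lo ≤ hi → sumRange lo hi g ≡ g lo + sumRange (suc lo) hi g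
  sumRange-head lo hi g lo≤hi rewrite ℕ.+-∸-assoc 1 lo≤hi = trans (sumTo-shift (hi ∸ lo) _)
    (cong₂ _+_ (cong g (ℕ.+-identityʳ lo)) (sumTo-cong (hi ∸ lo) (λ k _ → cong g (ℕ.+-suc lo k))))

  sumRange-snoc : ∀ lo hi g → lo ≤ suc hi → sumRange lo (suc hi) g ≡ sumRange lo hi g + g (suc hi)
  sumRange-snoc lo hi g lo≤ rewrite ℕ.+-∸-assoc 1 lo≤ = cong (λ i → sumRange lo hi g + g i) (ℕ.m+[n∸m]≡n lo≤)

  sumRange-single : ∀ n g → sumRange n n g ≡ g n
  sumRange-single n g = begin
    sumRange n n g                  ≡⟨ sumRange-head n n g ℕ.≤-refl ⟩
    g n + sumRange (suc n) n g      ≡⟨ cong (g n +_) (sumRange-empty (suc n) n g ℕ.≤-refl) ⟩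
    g n + 0ℚ                        ≡⟨ +-identityʳ (g n) ⟩
    g n                             ∎

  sumRange-dropHead : ∀ lo hi g → g lo ≡ 0ℚ → sumRange lo hi g ≡ sumRange (suc lo) hi g
  sumRange-dropHead lo hi g g[lo]≡0 with lo ℕ.≤? hi
  ... | yes lo≤hi = trans (sumRange-head lo hi g lo≤hi) (trans (cong (_+ sumRange (suc lo) hi g) g[lo]≡0) (+-identityˡ _))
  ... | no lo≰hi = trans (sumRange-empty lo hi g hi<lo) (sym (sumRange-empty (suc lo) hi g (ℕ.m<n⇒m<1+n hi<lo)))
    where hi<lo = ℕ.≰⇒> lo≰hi

  sumList-++ : ∀ xs ys f → sumList (xs ++ ys) f ≡ sumList xs f + sumList ys f
  sumList-++ [] ys f = sym (+-identityˡ (sumList ys f))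
  sumList-++ (x ∷ xs) ys f = trans (cong (f x +_) (sumList-++ xs ys f)) (sym (+-assoc (f x) _ _))

  sumList-map-∷ : ∀ i xs f → sumList (map (i ∷_) xs) f ≡ sumList xs (λ is → f (i ∷ is))
  sumList-map-∷ i [] f = refl
  sumList-map-∷ i (x ∷ xs) f = cong (f (i ∷ x) +_) (sumList-map-∷ i xs f)

  sumList-cong : ∀ xs {f g : List ℕ → ℚ} → (∀ is → f is ≡ g is) → sumList xs f ≡ sumList xs g
  sumList-cong [] f≗g = refl
  sumList-cong (x ∷ xs) f≗g = cong₂ _+_ (f≗g x) (sumList-cong xs f≗g)

  sumList-*ˡ : ∀ xs c f → sumList xs (λ is → c * f is) ≡ c * sumList xs f
  sumList-*ˡ [] c f = sym (*-zeroʳ c)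
  sumList-*ˡ (x ∷ xs) c f = trans (cong (c * f x +_) (sumList-*ˡ xs c f)) (sym (*-distribˡ-+ c (f x) _))

  sumList-zero : ∀ xs f → (∀ is → f is ≡ 0ℚ) → sumList xs f ≡ 0ℚ
  sumList-zero [] f f≗0 = refl
  sumList-zero (x ∷ xs) f f≗0 = trans (cong₂ _+_ (f≗0 x) (sumList-zero xs f f≗0)) (+-identityˡ 0ℚ)

  sumList-concatMap-applyUpTo : ∀ F (h : ℕ → ℕ) n f →
    sumList (concatMap F (applyUpTo h n)) f ≡ sumTo n (λ k → sumList (F (h k)) f)
  sumList-concatMap-applyUpTo F h zero f = refl
  sumList-concatMap-applyUpTo F h (suc n) f = begin
    sumList (concatMap F (applyUpTo h (suc n))) f
      ≡⟨ cong (λ xs → sumList (concatMap F xs) f) (applyUpTo-∷ʳ h n) ⟨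
    sumList (concatMap F (applyUpTo h n ∷ʳ h n)) f
      ≡⟨ cong (λ xss → sumList xss f) (concatMap-++ F (applyUpTo h n) [ h n ]) ⟩
    sumList (concatMap F (applyUpTo h n) ++ (F (h n) ++ [])) f
      ≡⟨ sumList-++ (concatMap F (applyUpTo h n)) _ f ⟩
    sumList (concatMap F (applyUpTo h n)) f + sumList (F (h n) ++ []) f
      ≡⟨ cong₂ _+_ (sumList-concatMap-applyUpTo F h n f) (cong (λ xss → sumList xss f) (++-identityʳ (F (h n)))) ⟩
    sumTo n (λ k → sumList (F (h k)) f) + sumList (F (h n)) f ∎

  sumList-incSeqs-suc : ∀ r lo hi f →
    sumList (incSeqs (suc r) lo hi) f ≡ sumRange lo hi (λ i → sumList (incSeqs r i hi) (λ is → f (i ∷ is)))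
  sumList-incSeqs-suc r lo hi f = begin
    sumList (concatMap F (map (lo ℕ.+_) (applyUpTo (λ k → k) (suc hi ∸ lo)))) f
      ≡⟨ cong (λ xs → sumList (concatMap F xs) f) (map-applyUpTo (λ k → k) (lo ℕ.+_) (suc hi ∸ lo)) ⟩
    sumList (concatMap F (applyUpTo (lo ℕ.+_) (suc hi ∸ lo))) f
      ≡⟨ sumList-concatMap-applyUpTo F (lo ℕ.+_) (suc hi ∸ lo) f ⟩
    sumRange lo hi (λ i → sumList (F i) f)
      ≡⟨ sumTo-cong (suc hi ∸ lo) (λ k _ → sumList-map-∷ (lo ℕ.+ k) (incSeqs r (lo ℕ.+ k) hi) f) ⟩
    sumRange lo hi (λ i → sumList (incSeqs r i hi) (λ is → f (i ∷ is))) ∎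
    where
    F : ℕ → List (List ℕ)
    F i = map (i ∷_) (incSeqs r i hi)

  parity : ∀ n → n % 2 ≡ 0 ⊎ n % 2 ≡ 1
  parity zero = inj₁ refl
  parity (suc zero) = inj₂ refl
  parity (suc (suc n)) = parity n

  2n%2≡0 : ∀ n → 2 ℕ.* n % 2 ≡ 0
  2n%2≡0 n = trans (cong (_% 2) (ℕ.*-comm 2 n)) (m*n%n≡0 n 2)

  [1+2n]%2≡1 : ∀ n → suc (2 ℕ.* n) % 2 ≡ 1
  [1+2n]%2≡1 n = trans (cong (λ m → suc m % 2) (ℕ.*-comm 2 n)) ([m+kn]%n≡m%n 1 n 2)

  ε-cons-even : ∀ {i} is → i % 2 ≡ 0 → ε (i ∷ is) ≡ ε is
  ε-cons-even [] _ = refl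
  ε-cons-even {i} (b ∷ is) even rewrite even | ∧-zeroʳ (does (i ℕ.≟ b)) = refl

  ε-cons-distinct : ∀ {i b} is → i ≢ b → ε (i ∷ b ∷ is) ≡ ε (b ∷ is)
  ε-cons-distinct {i} {b} is i≢b rewrite dec-false (i ℕ.≟ b) i≢b = refl

  ε-repeat-odd : ∀ {i} is → i % 2 ≡ 1 → ε (i ∷ i ∷ is) ≡ 0ℚ
  ε-repeat-odd {i} is odd rewrite dec-true (i ℕ.≟ i) refl | odd = refl

  term-cons : ∀ i is → ε (i ∷ is) ≡ ε is → term (i ∷ is) ≡ altInvSq i * term is
  term-cons i is ε≡ = begin
    sgn (i ℕ.+ sumℕ is) * inv (fromℕ (i ℕ.* i ℕ.* prodSq is)) * ε (i ∷ is)
      ≡⟨ cong₃ (sgn-+ i (sumℕ is))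
               (trans (cong inv (fromℕ-* (i ℕ.* i) (prodSq is))) (inv-* (fromℕ (i ℕ.* i)) (fromℕ (prodSq is))))
               ε≡ ⟩
    sgn i * sgn (sumℕ is) * (inv (fromℕ (i ℕ.* i)) * inv (fromℕ (prodSq is))) * ε is
      ≡⟨ solve 5 (λ s t u v e → s :* t :* (u :* v) :* e := s :* u :* (t :* v :* e)) refl
           (sgn i) (sgn (sumℕ is)) (inv (fromℕ (i ℕ.* i))) (inv (fromℕ (prodSq is))) (ε is) ⟩
    altInvSq i * term is ∎
    where
    cong₃ : ∀ {s s′ v v′ e e′} → s ≡ s′ → v ≡ v′ → e ≡ e′ → s * v * e ≡ s′ * v′ * e′
    cong₃ refl refl refl = refl

  -- In a sequence with ε = 1 the index after an odd i must exceed i, while after an even i it may be i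
  -- again: nextStart i is the least admissible successor of i, lastBefore m the largest admissible
  -- predecessor of m.
  nextStart : ℕ → ℕ
  nextStart i = i % 2 ℕ.+ i

  lastBefore : ℕ → ℕ
  lastBefore m = m ∸ m % 2

  nextStart≤suc : ∀ i → nextStart i ≤ suc i
  nextStart≤suc i with parity i
  ... | inj₁ even rewrite even = ℕ.n≤1+n i
  ... | inj₂ odd rewrite odd = ℕ.≤-refl

  multipleSum : ℕ → ℕ → ℕ → ℚ
  multipleSum r lo hi = sumList (incSeqs r lo hi) term

  multipleSum-cons : ∀ r i hi →
    sumList (incSeqs r i hi) (λ is → term (i ∷ is)) ≡ altInvSq i * multipleSum r (nextStart i) hi
  multipleSum-cons r i hi with parity i
  ... | inj₁ even rewrite even =
    trans (sumList-cong (incSeqs r i hi) (λ is → term-cons i is (ε-cons-even is even))) (sumList-*ˡ (incSeqs r i hi) (altInvSq i) term)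
  ... | inj₂ odd rewrite odd = odd-case r
    where
    odd-case : ∀ r → sumList (incSeqs r i hi) (λ is → term (i ∷ is)) ≡ altInvSq i * multipleSum r (suc i) hi
    odd-case zero = trans (cong (_+ 0ℚ) (term-cons i [] refl)) (+-identityʳ _)
    odd-case (suc r) = begin
      sumList (incSeqs (suc r) i hi) (λ is → term (i ∷ is))
        ≡⟨ sumList-incSeqs-suc r i hi (λ is → term (i ∷ is)) ⟩
      sumRange i hi (λ b → sumList (incSeqs r b hi) (λ is → term (i ∷ b ∷ is)))
        ≡⟨ sumRange-dropHead i hi (λ b → sumList (incSeqs r b hi) (λ is → term (i ∷ b ∷ is)))
             (sumList-zero (incSeqs r i hi) _ repeat≡0) ⟩
      sumRange (suc i) hi (λ b → sumList (incSeqs r b hi) (λ is → term (i ∷ b ∷ is)))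
        ≡⟨ sumRange-cong (suc i) hi (λ b i<b _ → trans
             (sumList-cong (incSeqs r b hi) (λ is → term-cons i (b ∷ is) (ε-cons-distinct is (ℕ.<⇒≢ i<b))))
             (sumList-*ˡ (incSeqs r b hi) (altInvSq i) (λ is → term (b ∷ is)))) ⟩
      sumRange (suc i) hi (λ b → altInvSq i * sumList (incSeqs r b hi) (λ is → term (b ∷ is)))
        ≡⟨ sumRange-*ˡ (suc i) hi (altInvSq i) (λ b → sumList (incSeqs r b hi) (λ is → term (b ∷ is))) ⟩
      altInvSq i * sumRange (suc i) hi (λ b → sumList (incSeqs r b hi) (λ is → term (b ∷ is)))
        ≡⟨ cong (altInvSq i *_) (sumList-incSeqs-suc r (suc i) hi term) ⟨
      altInvSq i * multipleSum (suc r) (suc i) hi ∎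
      where
      repeat≡0 : ∀ is → term (i ∷ i ∷ is) ≡ 0ℚ
      repeat≡0 is = trans (cong (c *_) (ε-repeat-odd is odd)) (*-zeroʳ c)
        where c = sgn (sumℕ (i ∷ i ∷ is)) * inv (fromℕ (prodSq (i ∷ i ∷ is)))

  multipleSum-suc : ∀ r lo hi →
    multipleSum (suc r) lo hi ≡ sumRange lo hi (λ i → altInvSq i * multipleSum r (nextStart i) hi)
  multipleSum-suc r lo hi =
    trans (sumList-incSeqs-suc r lo hi term) (sumTo-cong (suc hi ∸ lo) (λ k _ → multipleSum-cons r (lo ℕ.+ k) hi))

  multipleSum-empty : ∀ r lo hi → hi < lo → multipleSum (suc r) lo hi ≡ 0ℚ
  multipleSum-empty r lo hi hi<lo =
    trans (multipleSum-suc r lo hi) (sumRange-empty lo hi (λ i → altInvSq i * multipleSum r (nextStart i) hi) hi<lo)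

  multipleSum-splitAtTop : ∀ r lo hi → lo ≤ suc hi →
    sumRange lo hi (λ i → altInvSq i * multipleSum r (nextStart i) (lastBefore (suc hi)))
      + multipleSum (suc r) (nextStart (suc hi)) (suc hi)
    ≡ multipleSum (suc r) lo (lastBefore (suc hi))
  multipleSum-splitAtTop r lo hi lo≤ with parity (suc hi)
  ... | inj₁ even rewrite even = begin
    sumRange lo hi g + multipleSum (suc r) (suc hi) (suc hi)
      ≡⟨ cong (sumRange lo hi g +_) (trans (multipleSum-suc r (suc hi) (suc hi)) (sumRange-single (suc hi) g)) ⟩
    sumRange lo hi g + g (suc hi)
      ≡⟨ sumRange-snoc lo hi g lo≤ ⟨
    sumRange lo (suc hi) g
      ≡⟨ multipleSum-suc r lo (suc hi) ⟨
    multipleSum (suc r) lo (suc hi) ∎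
    where
    g : ℕ → ℚ
    g i = altInvSq i * multipleSum r (nextStart i) (suc hi)
  ... | inj₂ odd rewrite odd = begin
    sumRange lo hi g + multipleSum (suc r) (suc (suc hi)) (suc hi)
      ≡⟨ cong₂ _+_ (sym (multipleSum-suc r lo hi)) (multipleSum-empty r (suc (suc hi)) (suc hi) ℕ.≤-refl) ⟩
    multipleSum (suc r) lo hi + 0ℚ
      ≡⟨ +-identityʳ _ ⟩
    multipleSum (suc r) lo hi ∎
    where
    g : ℕ → ℚ
    g i = altInvSq i * multipleSum r (nextStart i) hi

  multipleSum-snoc : ∀ r lo hi → lo ≤ suc hi →
    multipleSum (suc r) lo (suc hi) ≡ multipleSum (suc r) lo hi + altInvSq (suc hi) * multipleSum r lo (lastBefore (suc hi))
  multipleSum-snoc zero lo hi lo≤ = begin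
    multipleSum 1 lo (suc hi)     ≡⟨ multipleSum-suc 0 lo (suc hi) ⟩
    sumRange lo (suc hi) g        ≡⟨ sumRange-snoc lo hi g lo≤ ⟩
    sumRange lo hi g + g (suc hi) ≡⟨ cong (_+ g (suc hi)) (multipleSum-suc 0 lo hi) ⟨
    multipleSum 1 lo hi + g (suc hi) ∎
    where
    g : ℕ → ℚ
    g i = altInvSq i * multipleSum 0 (nextStart i) (suc hi)
  multipleSum-snoc (suc r) lo hi lo≤ = begin
    multipleSum (2 ℕ.+ r) lo (suc hi)
      ≡⟨ multipleSum-suc (suc r) lo (suc hi) ⟩
    sumRange lo (suc hi) G
      ≡⟨ sumRange-snoc lo hi G lo≤ ⟩
    sumRange lo hi G + G (suc hi)
      ≡⟨ cong (_+ G (suc hi)) lower ⟩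
    multipleSum (2 ℕ.+ r) lo hi + a * sumRange lo hi g + a * multipleSum (suc r) (nextStart (suc hi)) (suc hi)
      ≡⟨ solve 4 (λ x a y z → x :+ a :* y :+ a :* z := x :+ a :* (y :+ z)) refl
           (multipleSum (2 ℕ.+ r) lo hi) a (sumRange lo hi g) (multipleSum (suc r) (nextStart (suc hi)) (suc hi)) ⟩
    multipleSum (2 ℕ.+ r) lo hi + a * (sumRange lo hi g + multipleSum (suc r) (nextStart (suc hi)) (suc hi))
      ≡⟨ cong (λ y → multipleSum (2 ℕ.+ r) lo hi + a * y) (multipleSum-splitAtTop r lo hi lo≤) ⟩
    multipleSum (2 ℕ.+ r) lo hi + a * multipleSum (suc r) lo (lastBefore (suc hi)) ∎
    where
    a = altInvSq (suc hi)
    G g : ℕ → ℚ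
    G i = altInvSq i * multipleSum (suc r) (nextStart i) (suc hi)
    g i = altInvSq i * multipleSum r (nextStart i) (lastBefore (suc hi))
    lower : sumRange lo hi G ≡ multipleSum (2 ℕ.+ r) lo hi + a * sumRange lo hi g
    lower = begin
      sumRange lo hi G
        ≡⟨ sumRange-cong lo hi (λ i _ i≤hi → cong (altInvSq i *_)
             (multipleSum-snoc r (nextStart i) hi (ℕ.≤-trans (nextStart≤suc i) (s≤s i≤hi)))) ⟩
      sumRange lo hi (λ i → altInvSq i * (multipleSum (suc r) (nextStart i) hi + a * multipleSum r (nextStart i) (lastBefore (suc hi))))
        ≡⟨ sumRange-cong lo hi (λ i _ _ → solve 4 (λ w x a y → w :* (x :+ a :* y) := w :* x :+ a :* (w :* y)) refl
             (altInvSq i) (multipleSum (suc r) (nextStart i) hi) a (multipleSum r (nextStart i) (lastBefore (suc hi)))) ⟩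
      sumRange lo hi (λ i → altInvSq i * multipleSum (suc r) (nextStart i) hi + a * g i)
        ≡⟨ sumRange-+ lo hi (λ i → altInvSq i * multipleSum (suc r) (nextStart i) hi) (λ i → a * g i) ⟩
      sumRange lo hi (λ i → altInvSq i * multipleSum (suc r) (nextStart i) hi) + sumRange lo hi (λ i → a * g i)
        ≡⟨ cong₂ _+_ (sym (multipleSum-suc (suc r) lo hi)) (sumRange-*ˡ lo hi a g) ⟩
      multipleSum (2 ℕ.+ r) lo hi + a * sumRange lo hi g ∎

  multipleSum-step : ∀ r lo p → lo ≤ suc (2 ℕ.* p) →
    multipleSum (suc r) lo (2 ℕ.* suc p)
      ≡ multipleSum (suc r) lo (2 ℕ.* p)
        + (altInvSq (2 ℕ.* suc p) * multipleSum r lo (2 ℕ.* suc p) + altInvSq (suc (2 ℕ.* p)) * multipleSum r lo (2 ℕ.* p))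
  multipleSum-step r lo p lo≤ = subst (λ m → M (suc r) m ≡ M (suc r) h + (altInvSq m * M r m + a₁ * M r h))
    (sym (2[1+n]≡2+2n p)) (begin
    M (suc r) (suc (suc h))
      ≡⟨ multipleSum-snoc r lo (suc h) (ℕ.m≤n⇒m≤1+n lo≤) ⟩
    M (suc r) (suc h) + a₂ * M r (lastBefore (suc (suc h)))
      ≡⟨ cong₂ (λ x m → x + a₂ * M r m) (multipleSum-snoc r lo h lo≤) lastBefore-even ⟩
    M (suc r) h + a₁ * M r (lastBefore (suc h)) + a₂ * M r (suc (suc h))
      ≡⟨ cong (λ m → M (suc r) h + a₁ * M r m + a₂ * M r (suc (suc h))) lastBefore-odd ⟩
    M (suc r) h + a₁ * M r h + a₂ * M r (suc (suc h))
      ≡⟨ solve 3 (λ x y z → x :+ y :+ z := x :+ (z :+ y)) refl (M (suc r) h) (a₁ * M r h) (a₂ * M r (suc (suc h))) ⟩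
    M (suc r) h + (a₂ * M r (suc (suc h)) + a₁ * M r h) ∎)
    where
    h = 2 ℕ.* p
    a₁ = altInvSq (suc h)
    a₂ = altInvSq (suc (suc h))
    M : ℕ → ℕ → ℚ
    M s = multipleSum s lo
    lastBefore-even : lastBefore (suc (suc h)) ≡ suc (suc h)
    lastBefore-even rewrite 2n%2≡0 p = refl
    lastBefore-odd : lastBefore (suc h) ≡ h
    lastBefore-odd rewrite [1+2n]%2≡1 p = refl

  multipleSum-diagonal : ∀ r n → n % 2 ≡ 0 → multipleSum (suc r) n n ≡ altInvSq n * multipleSum r n n
  multipleSum-diagonal r n even = begin
    multipleSum (suc r) n n                  ≡⟨ multipleSum-suc r n n ⟩
    sumRange n n (λ i → altInvSq i * multipleSum r (nextStart i) n)
                                             ≡⟨ sumRange-single n (λ i → altInvSq i * multipleSum r (nextStart i) n) ⟩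
    altInvSq n * multipleSum r (nextStart n) n ≡⟨ cong (λ m → altInvSq n * multipleSum r m n) (cong (ℕ._+ n) even) ⟩
    altInvSq n * multipleSum r n n           ∎

  Recurrence : (ℕ → ℕ → ℚ) → Set
  Recurrence X = ∀ r p →
    X (suc r) (suc p) ≡ X (suc r) p + (altInvSq (2 ℕ.* suc p) * X r (suc p) + altInvSq (suc (2 ℕ.* p)) * X r p)

  Recurrence-unique : ∀ {X Y} → Recurrence X → Recurrence Y →
    (∀ p → X 0 p ≡ Y 0 p) → (∀ r → X (suc r) 0 ≡ Y (suc r) 0) → ∀ r p → X r p ≡ Y r p
  Recurrence-unique {X} {Y} recX recY X0≡Y0 Xr0≡Yr0 = go
    where
    go : ∀ r p → X r p ≡ Y r p
    go zero p = X0≡Y0 p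
    go (suc r) zero = Xr0≡Yr0 r
    go (suc r) (suc p) = trans (recX r p) (trans
      (cong₂ _+_ (go (suc r) p) (cong₂ (λ x y → altInvSq (2 ℕ.* suc p) * x + altInvSq (suc (2 ℕ.* p)) * y) (go r (suc p)) (go r p)))
      (sym (recY r p)))

  double : ℕ → ℕ
  double zero = zero
  double (suc n) = suc (suc (double n))

  c+double≡2*+c : ∀ c n → c ℕ.+ double n ≡ 2 ℕ.* n ℕ.+ c
  c+double≡2*+c c n = trans (cong (c ℕ.+_) (double≡2* n)) (ℕ.+-comm c (2 ℕ.* n))
    where
    double≡2* : ∀ n → double n ≡ 2 ℕ.* n
    double≡2* zero = refl
    double≡2* (suc n) = trans (cong (λ m → suc (suc m)) (double≡2* n)) (sym (2[1+n]≡2+2n n))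

  evenRHS-recurrence : Recurrence evenRHS
  evenRHS-recurrence r p = multipleSum-step r 1 p (s≤s z≤n)

  S-even : ∀ r p → S (2 ℕ.+ double r) p ≡ evenRHS r p
  S-even = Recurrence-unique (λ r → S-suc (double r)) evenRHS-recurrence (λ _ → refl) (λ _ → refl)

  oddRHS-recurrence : Recurrence oddRHS
  oddRHS-recurrence r p = begin
    - fromℕ 2 * (sumTo p (T (suc r) H) + c p * multipleSum (suc r) H H)
      ≡⟨ cong₂ (λ x y → - fromℕ 2 * (x + c p * y)) inner (multipleSum-diagonal r H (2n%2≡0 (suc p))) ⟩
    - fromℕ 2 * (X + (a₂ * Y + a₁ * Z) + c p * (a₂ * Q))
      ≡⟨ solve 8 (λ t x y z q c a₁ a₂ → (:- t) :* (x :+ (a₂ :* y :+ a₁ :* z) :+ c :* (a₂ :* q))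
                     := (:- t) :* x :+ (a₂ :* ((:- t) :* (y :+ c :* q)) :+ a₁ :* ((:- t) :* z)))
           refl (fromℕ 2) X Y Z Q (c p) a₁ a₂ ⟩
    oddRHS (suc r) p + (a₂ * oddRHS r (suc p) + a₁ * oddRHS r p) ∎
    where
    h = 2 ℕ.* p
    H = 2 ℕ.* suc p
    a₁ = altInvSq (suc h)
    a₂ = altInvSq H
    c : ℕ → ℚ
    c j = inv (fromℕ (2 ℕ.* j ℕ.+ 1) ^ 3) * binvsq j
    T : ℕ → ℕ → ℕ → ℚ
    T s top j = c j * multipleSum s (2 ℕ.* suc j) top
    X = sumTo p (T (suc r) h)
    Y = sumTo p (T r H)
    Z = sumTo p (T r h)
    Q = multipleSum r H H
    T-step : ∀ j → j < p → T (suc r) H j ≡ T (suc r) h j + (a₂ * T r H j + a₁ * T r h j)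
    T-step j j<p = begin
      c j * multipleSum (suc r) (2 ℕ.* suc j) H
        ≡⟨ cong (c j *_) (multipleSum-step r (2 ℕ.* suc j) p (ℕ.m≤n⇒m≤1+n (ℕ.*-monoʳ-≤ 2 j<p))) ⟩
      c j * (multipleSum (suc r) (2 ℕ.* suc j) h + (a₂ * multipleSum r (2 ℕ.* suc j) H + a₁ * multipleSum r (2 ℕ.* suc j) h))
        ≡⟨ solve 6 (λ c x a₂ y a₁ z → c :* (x :+ (a₂ :* y :+ a₁ :* z)) := c :* x :+ (a₂ :* (c :* y) :+ a₁ :* (c :* z))) refl
             (c j) (multipleSum (suc r) (2 ℕ.* suc j) h) a₂ (multipleSum r (2 ℕ.* suc j) H) a₁ (multipleSum r (2 ℕ.* suc j) h) ⟩
      T (suc r) h j + (a₂ * T r H j + a₁ * T r h j) ∎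
    inner : sumTo p (T (suc r) H) ≡ X + (a₂ * Y + a₁ * Z)
    inner = begin
      sumTo p (T (suc r) H)
        ≡⟨ sumTo-cong p T-step ⟩
      sumTo p (λ j → T (suc r) h j + (a₂ * T r H j + a₁ * T r h j))
        ≡⟨ sumTo-+ p (T (suc r) h) _ ⟩
      X + sumTo p (λ j → a₂ * T r H j + a₁ * T r h j)
        ≡⟨ cong (X +_) (trans (sumTo-+ p _ _) (cong₂ _+_ (sumTo-*ˡ p a₂ (T r H)) (sumTo-*ˡ p a₁ (T r h)))) ⟩
      X + (a₂ * Y + a₁ * Z) ∎

  S-odd : ∀ r p → S (3 ℕ.+ double r) p ≡ oddRHS r p
  S-odd = Recurrence-unique (λ r → S-suc (suc (double r))) oddRHS-recurrence
    (λ p → cong (- fromℕ 2 *_) (sumTo-cong p (λ j _ → sym (*-identityʳ _)))) (λ _ → refl)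

open import Data.Nat using (ℕ; suc; _+_; _*_; _≤_)
open import Data.Product using (_×_; _,_)
open import Relation.Binary.PropositionalEquality using (_≡_; subst)

-- The identities hold for r = 0 as well.
mainTheorem8 : (r : ℕ) → 1 ≤ r → (p : ℕ) →
    (S (2 * r + 2) p ≡ evenRHS r p) × (S (2 * r + 3) p ≡ oddRHS r p)
mainTheorem8 r _ p =
  subst (λ k → S k p ≡ evenRHS r p) (c+double≡2*+c 2 r) (S-even r p) ,
  subst (λ k → S k p ≡ oddRHS r p) (c+double≡2*+c 3 r) (S-odd r p)
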